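{- Let $S=\{x_1,x_2,\ldots,x_t\}$ be a gcd-closed set of distinct positive integers with $t>5$. Let $x_n\in S$ with $n\ge5$ such that $G_S(x_n)=\{x_2,\ldots,x_{n-1}\}$, $\gcd(G_S(x_n))=x_1$ and $D_S(x_n)=\{x_1,x_{n+1},\ldots,x_m\}$ with $m<t$. If $x_i\mid x_n$ for all $n<i\le t$ and $D_S(x_n)$ is a divisor chain, then $(S)\nmid[S]$.
   Context: $S$ is gcd-closed if $\gcd(x,y)\in S$ for all $x,y\in S$. The GCD matrix $(S)$ is the $t\times t$ matrix with $(i,j)$-entry $\gcd(x_i,x_j)$; the LCM matrix $[S]$ has $(i,j)$-entry $\mathrm{lcm}(x_i,x_j)$. For $A,B\in M_t(\mathbb{Z})$, $A\mid B$ means there is $C\in M_t(\mathbb{Z})$ with $B=AC$ or $B=CA$; $A\nmid B$ otherwise. For $x<y$ in $S$, $x$ is a greatest-type divisor of $y$ in $S$ if $x\mid y$ and $x\mid z\mid y$, $z\in S$ imply $z\in\{x,y\}$; $G_S(y)$ is the set of greatest-type divisors of $y$ in $S$. If $G_S(x)=\{y_1,\ldots,y_k\}$, then $D_S(x)=\{\gcd(y_{i_1},\ldots,y_{i_r}): 2\le r\le k,\ 1\le i_1<\cdots<i_r\le k\}$. A divisor chain is a set totally ordered by divisibility. -}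

module Defs where

open import Data.Nat using (ℕ; zero; suc; _<_; _≤_)
open import Data.Nat.Divisibility using (_∣_)
open import Data.Nat.GCD using (gcd)
open import Data.Nat.LCM using (lcm)
open import Data.Fin using (Fin; toℕ)
import Data.Fin as F
open import Data.Integer as ℤ using (ℤ; +_)
open import Data.List using (List; foldr; length; _∷_; [])
open import Data.List.Relation.Unary.All using (All)
open import Data.List.Relation.Unary.Unique.Propositional using (Unique)
open import Data.Product using (Σ; ∃; _×_)
open import Data.Sum using (_⊎_)
open import Relation.Binary.PropositionalEquality using (_≡_)
open import Relation.Nullary using (¬_)

-- A finite set S = {x_1,...,x_t} is given by an enumeration x : Fin t → ℕ
-- (0-based: x zero is x_1).

_∈S_ : {t : ℕ} → ℕ → (Fin t → ℕ) → Set
a ∈S x = ∃ λ i → x i ≡ a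

GcdClosed : {t : ℕ} → (Fin t → ℕ) → Set
GcdClosed x = ∀ i j → gcd (x i) (x j) ∈S x

IsGTD : {t : ℕ} → (Fin t → ℕ) → ℕ → ℕ → Set
IsGTD x a y =
  a ∈S x × y ∈S x × a < y × a ∣ y ×
  (∀ z → z ∈S x → a ∣ z → z ∣ y → z ≡ a ⊎ z ≡ y)

-- gcd of a finite list of numbers (gcd of the empty list is 0, unused)
gcdList : List ℕ → ℕ
gcdList = foldr gcd 0

IsGcdOf : (ℕ → Set) → ℕ → Set
IsGcdOf P g = (∀ a → P a → g ∣ a) × (∀ d → (∀ a → P a → d ∣ a) → d ∣ g)

InD : {t : ℕ} → (Fin t → ℕ) → ℕ → ℕ → Set
InD x y a = Σ (List ℕ) λ L →
  Unique L × All (λ b → IsGTD x b y) L × 2 ≤ length L × gcdList L ≡ a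

DivisorChain : (ℕ → Set) → Set
DivisorChain P = ∀ a b → P a → P b → a ∣ b ⊎ b ∣ a

Matrix : ℕ → Set
Matrix t = Fin t → Fin t → ℤ

sumFin : (t : ℕ) → (Fin t → ℤ) → ℤ
sumFin zero f = + 0
sumFin (suc t) f = f F.zero ℤ.+ sumFin t (λ i → f (F.suc i))

_·_ : {t : ℕ} → Matrix t → Matrix t → Matrix t
_·_ {t} A B i j = sumFin t (λ k → A i k ℤ.* B k j)

_≐_ : {t : ℕ} → Matrix t → Matrix t → Set
A ≐ B = ∀ i j → A i j ≡ B i j

_∣ₘ_ : {t : ℕ} → Matrix t → Matrix t → Set
_∣ₘ_ {t} A B = ∃ λ (C : Matrix t) → (B ≐ (A · C)) ⊎ (B ≐ (C · A))

GCDMatrix : {t : ℕ} → (Fin t → ℕ) → Matrix t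
GCDMatrix x i j = + gcd (x i) (x j)

LCMMatrix : {t : ℕ} → (Fin t → ℕ) → Matrix t
LCMMatrix x i j = + lcm (x i) (x j)

module Submission where

-- 1. Because D_S(M) is a chain, some greatest-type divisor g is isolated:
--    gcd(g, h) = e for every other greatest-type divisor h (ChainSetting).
-- 2. Listing the greatest-type divisors as g, h₁, …, h_k, the
--    inclusion–exclusion vector w = Σ_J (-1)^|J| δ_{gcd(M, J)} of the gcd-lattice
--    they generate with M kills every column of (S) except the n-th, since
--    every other x_k divides some greatest-type divisor.  So w·(S) = α·δₙ.
-- 3. Both α and V = (w·[S])_g are counts of residues r < M (via
--    Σ_{r<M} [M ∣ r·b] = gcd(M, b)), and comparing the counts gives 0 < V < α.
-- 4. If [S] = (S)·C or [S] = C·(S), then V would be a multiple of α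
--    (row-criterion, using symmetry of both matrices); contradiction.

open import Defs
open import Data.Nat as ℕ using (ℕ; zero; suc; _<_; _≤_; _∸_; z≤n; s≤s; NonZero)
import Data.Nat.Properties as ℕP
open import Data.Nat.Divisibility
open import Data.Nat.GCD using (gcd; gcd-assoc; gcd-comm; gcd[m,n]∣m; gcd[m,n]∣n; gcd-greatest;
  c*gcd[m,n]≡gcd[cm,cn]; gcd-identityʳ)
open import Data.Nat.LCM using (lcm; lcm-least; m∣lcm[m,n]; n∣lcm[m,n]; gcd*lcm; lcm-comm)
open import Data.Nat.Coprimality using (coprime-divisor; gcd≡1⇒coprime)
import Data.Nat.Tactic.RingSolver as ℕSolver
open import Data.Fin as F using (Fin; toℕ)
import Data.Fin.Properties as FP
open import Data.Integer as ℤ using (ℤ; +_; _+_; _*_; _-_; -_)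
import Data.Integer.Properties as ℤP
open import Data.Integer.Tactic.RingSolver using (solve-∀)
open import Data.List using (List; []; _∷_; map; filter; allFin)
open import Data.List.Relation.Unary.All as All using (All; []; _∷_)
open import Data.List.Relation.Unary.Any as Any using (Any; here; there)
open import Data.List.Relation.Unary.AllPairs using ([]; _∷_)
open import Data.List.Membership.Propositional using (_∈_; lose)
open import Data.List.Membership.Propositional.Properties using (∈-map⁺; ∈-map⁻; ∈-filter⁺; ∈-filter⁻; ∈-allFin)
open import Data.Empty using (⊥; ⊥-elim)
open import Data.Unit using (⊤; tt)
open import Data.Product using (Σ; ∃; _×_; _,_; proj₁; proj₂)
open import Data.Sum using (_⊎_; inj₁; inj₂)
open import Relation.Binary.PropositionalEquality
open import Relation.Nullary using (Dec; yes; no; ¬_)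
open import Relation.Binary.Definitions using (tri<; tri≈; tri>)
open import Relation.Nullary.Decidable using (decidable-stable; _×-dec_; _⊎-dec_; ¬?)
open import Function.Bundles using (_⇔_; Equivalence; mk⇔)
open import Function.Definitions using (Injective)

sumFin-cong : ∀ t {f g : Fin t → ℤ} → (∀ k → f k ≡ g k) → sumFin t f ≡ sumFin t g
sumFin-cong zero    e = refl
sumFin-cong (suc t) e = cong₂ _+_ (e F.zero) (sumFin-cong t (λ k → e (F.suc k)))

sumFin-zero : ∀ t → sumFin t (λ _ → + 0) ≡ + 0
sumFin-zero zero    = refl
sumFin-zero (suc t) = trans (ℤP.+-identityˡ _) (sumFin-zero t)

sumFin-+ : ∀ t (f g : Fin t → ℤ) → sumFin t (λ k → f k + g k) ≡ sumFin t f + sumFin t g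
sumFin-+ zero    f g = refl
sumFin-+ (suc t) f g = trans (cong (_+_ (f F.zero + g F.zero)) (sumFin-+ t (λ k → f (F.suc k)) (λ k → g (F.suc k))))
  (interchange (f F.zero) (g F.zero) _ _)
  where
  interchange : ∀ a b c d → a + b + (c + d) ≡ a + c + (b + d)
  interchange = solve-∀

sumFin-*ˡ : ∀ t (c : ℤ) (f : Fin t → ℤ) → sumFin t (λ k → c * f k) ≡ c * sumFin t f
sumFin-*ˡ zero    c f = sym (ℤP.*-zeroʳ c)
sumFin-*ˡ (suc t) c f = trans (cong (_+_ (c * f F.zero)) (sumFin-*ˡ t c _)) (sym (ℤP.*-distribˡ-+ c _ _))

sumFin-*ʳ : ∀ t (c : ℤ) (f : Fin t → ℤ) → sumFin t (λ k → f k * c) ≡ sumFin t f * c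
sumFin-*ʳ t c f = begin
  sumFin t (λ k → f k * c) ≡⟨ sumFin-cong t (λ k → ℤP.*-comm (f k) c) ⟩
  sumFin t (λ k → c * f k) ≡⟨ sumFin-*ˡ t c f ⟩
  c * sumFin t f           ≡⟨ ℤP.*-comm c _ ⟩
  sumFin t f * c           ∎
  where open ≡-Reasoning

sumFin-- : ∀ t (f g : Fin t → ℤ) → sumFin t (λ k → f k - g k) ≡ sumFin t f - sumFin t g
sumFin-- t f g = begin
  sumFin t (λ k → f k - g k)          ≡⟨ sumFin-+ t f (λ k → - g k) ⟩
  sumFin t f + sumFin t (λ k → - g k) ≡⟨ cong (_+_ (sumFin t f)) negate ⟩
  sumFin t f - sumFin t g             ∎
  where
  open ≡-Reasoning
  negate : sumFin t (λ k → - g k) ≡ - sumFin t g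
  negate = trans (sumFin-cong t (λ k → sym (ℤP.-1*i≡-i (g k))))
                 (trans (sumFin-*ˡ t ℤ.-1ℤ g) (ℤP.-1*i≡-i _))

sumFin-swap : ∀ t s (F : Fin t → Fin s → ℤ) →
  sumFin t (λ i → sumFin s (F i)) ≡ sumFin s (λ k → sumFin t (λ i → F i k))
sumFin-swap zero    s F = sym (sumFin-zero s)
sumFin-swap (suc t) s F = trans (cong (_+_ (sumFin s (F F.zero))) (sumFin-swap t s _))
  (sym (sumFin-+ s (F F.zero) (λ k → sumFin t (λ i → F (F.suc i) k))))

δ : ∀ {t} → Fin t → Fin t → ℤ
δ F.zero    F.zero    = + 1
δ F.zero    (F.suc _) = + 0
δ (F.suc _) F.zero    = + 0
δ (F.suc a) (F.suc b) = δ a b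

sumFin-δ : ∀ t (a : Fin t) (f : Fin t → ℤ) → sumFin t (λ k → δ a k * f k) ≡ f a
sumFin-δ (suc t) F.zero f = trans
  (cong₂ _+_ (ℤP.*-identityˡ (f F.zero))
             (trans (sumFin-cong t (λ k → ℤP.*-zeroˡ (f (F.suc k)))) (sumFin-zero t)))
  (ℤP.+-identityʳ _)
sumFin-δ (suc t) (F.suc a) f =
  trans (ℤP.+-identityˡ _) (sumFin-δ t a (λ k → f (F.suc k)))

δ-refl : ∀ {t} (a : Fin t) → δ a a ≡ + 1
δ-refl F.zero    = refl
δ-refl (F.suc a) = δ-refl a

δ-neq : ∀ {t} (a b : Fin t) → a ≢ b → δ a b ≡ + 0
δ-neq F.zero    F.zero    ne = ⊥-elim (ne refl)
δ-neq F.zero    (F.suc b) ne = refl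
δ-neq (F.suc a) F.zero    ne = refl
δ-neq (F.suc a) (F.suc b) ne = δ-neq a b (λ e → ne (cong F.suc e))

not-multiple : ∀ {α V} c → + 0 ℤ.< V → V ℤ.< α → V ≢ α * c
not-multiple {+ a} {+ v} c (ℤ.+<+ 0<v) (ℤ.+<+ v<a) V≡αc =
  impossible ℤ.∣ c ∣ (trans (cong ℤ.∣_∣ V≡αc) (ℤP.abs-* (+ a) c))
  where
  impossible : ∀ k → v ≢ a ℕ.* k
  impossible zero    v≡ = ℕP.<⇒≢ 0<v (sym (trans v≡ (ℕP.*-zeroʳ a)))
  impossible (suc k) v≡ = ℕP.<⇒≱ v<a (subst (a ≤_) (sym v≡) (ℕP.m≤m*n a (suc k)))

SymmetricMatrix : ∀ {t} → Matrix t → Set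
SymmetricMatrix A = ∀ i j → A i j ≡ A j i

-- Suppose the row vector w satisfies wA = α·δₙ,
-- i.e. w annihilates every column of A except the n-th.  Then for B = AC the
-- g-th entry of wB equals α·C n g, and for B = CA (A, B symmetric) it equals
-- α·C g n; either way it is a multiple of α.
row-criterion : ∀ {t} (A B : Matrix t) → SymmetricMatrix A → SymmetricMatrix B →
  (w : Fin t → ℤ) (n g : Fin t) (α : ℤ) →
  (∀ k → sumFin t (λ i → w i * A i k) ≡ α * δ n k) →
  + 0 ℤ.< sumFin t (λ i → w i * B i g) → sumFin t (λ i → w i * B i g) ℤ.< α →
  ¬ (A ∣ₘ B)
row-criterion {t} A B symA symB w n g α wA≡αδ 0<V V<α (C , inj₁ B≐AC) =
  not-multiple (C n g) 0<V V<α (begin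
    sumFin t (λ i → w i * B i g)                             ≡⟨ sumFin-cong t (λ i → cong (w i *_) (B≐AC i g)) ⟩
    sumFin t (λ i → w i * sumFin t (λ k → A i k * C k g))    ≡⟨ sumFin-cong t (λ i → sym (sumFin-*ˡ t (w i) _)) ⟩
    sumFin t (λ i → sumFin t (λ k → w i * (A i k * C k g)))  ≡⟨ sumFin-swap t t _ ⟩
    sumFin t (λ k → sumFin t (λ i → w i * (A i k * C k g)))  ≡⟨ sumFin-cong t column ⟩
    sumFin t (λ k → δ n k * (α * C k g))                     ≡⟨ sumFin-δ t n (λ k → α * C k g) ⟩
    α * C n g                                                ∎)
  where
  open ≡-Reasoning
  reassoc : ∀ (a b c : ℤ) → a * (b * c) ≡ (a * b) * c
  reassoc = solve-∀
  shuffle : ∀ (α d c : ℤ) → (α * d) * c ≡ d * (α * c)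
  shuffle = solve-∀
  column : ∀ k → sumFin t (λ i → w i * (A i k * C k g)) ≡ δ n k * (α * C k g)
  column k = begin
    sumFin t (λ i → w i * (A i k * C k g)) ≡⟨ sumFin-cong t (λ i → reassoc (w i) (A i k) (C k g)) ⟩
    sumFin t (λ i → w i * A i k * C k g)   ≡⟨ sumFin-*ʳ t (C k g) (λ i → w i * A i k) ⟩
    sumFin t (λ i → w i * A i k) * C k g   ≡⟨ cong (_* C k g) (wA≡αδ k) ⟩
    α * δ n k * C k g                      ≡⟨ shuffle α (δ n k) (C k g) ⟩
    δ n k * (α * C k g)                    ∎
row-criterion {t} A B symA symB w n g α wA≡αδ 0<V V<α (C , inj₂ B≐CA) =
  not-multiple (C g n) 0<V V<α (begin
    sumFin t (λ j → w j * B j g)                             ≡⟨ sumFin-cong t (λ j → cong (w j *_) (trans (symB j g) (B≐CA g j))) ⟩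
    sumFin t (λ j → w j * sumFin t (λ k → C g k * A k j))    ≡⟨ sumFin-cong t (λ j → sym (sumFin-*ˡ t (w j) _)) ⟩
    sumFin t (λ j → sumFin t (λ k → w j * (C g k * A k j)))  ≡⟨ sumFin-swap t t _ ⟩
    sumFin t (λ k → sumFin t (λ j → w j * (C g k * A k j)))  ≡⟨ sumFin-cong t column ⟩
    sumFin t (λ k → δ n k * (α * C g k))                     ≡⟨ sumFin-δ t n (λ k → α * C g k) ⟩
    α * C g n                                                ∎)
  where
  open ≡-Reasoning
  pull : ∀ (w c a : ℤ) → w * (c * a) ≡ c * (w * a)
  pull = solve-∀
  shuffle : ∀ (c α d : ℤ) → c * (α * d) ≡ d * (α * c)
  shuffle = solve-∀
  column : ∀ k → sumFin t (λ j → w j * (C g k * A k j)) ≡ δ n k * (α * C g k)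
  column k = begin
    sumFin t (λ j → w j * (C g k * A k j)) ≡⟨ sumFin-cong t (λ j → pull (w j) (C g k) (A k j)) ⟩
    sumFin t (λ j → C g k * (w j * A k j)) ≡⟨ sumFin-*ˡ t (C g k) (λ j → w j * A k j) ⟩
    C g k * sumFin t (λ j → w j * A k j)   ≡⟨ cong (λ s → C g k * s) (trans (sumFin-cong t (λ j → cong (w j *_) (symA k j))) (wA≡αδ k)) ⟩
    C g k * (α * δ n k)                    ≡⟨ shuffle (C g k) α (δ n k) ⟩
    δ n k * (α * C g k)                    ∎

sumBelow : ℕ → (ℕ → ℤ) → ℤ
sumBelow zero    f = + 0
sumBelow (suc N) f = f N + sumBelow N f

sumBelow-cong : ∀ N {f g : ℕ → ℤ} → (∀ r → r < N → f r ≡ g r) → sumBelow N f ≡ sumBelow N g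
sumBelow-cong zero    e = refl
sumBelow-cong (suc N) e = cong₂ _+_ (e N ℕP.≤-refl) (sumBelow-cong N (λ r r<N → e r (ℕP.m<n⇒m<1+n r<N)))

sumBelow-zero : ∀ N → sumBelow N (λ _ → + 0) ≡ + 0
sumBelow-zero zero    = refl
sumBelow-zero (suc N) = trans (ℤP.+-identityˡ _) (sumBelow-zero N)

sumBelow-- : ∀ N (f g : ℕ → ℤ) → sumBelow N (λ r → f r - g r) ≡ sumBelow N f - sumBelow N g
sumBelow-- zero    f g = refl
sumBelow-- (suc N) f g = trans (cong (_+_ (f N - g N)) (sumBelow-- N f g)) (interchange (f N) (g N) _ _)
  where
  interchange : ∀ a b c d → (a - b) + (c - d) ≡ (a + c) - (b + d)
  interchange = solve-∀

sumBelow-split : ∀ m N (f : ℕ → ℤ) → sumBelow (m ℕ.+ N) f ≡ sumBelow m (λ i → f (N ℕ.+ i)) + sumBelow N f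
sumBelow-split zero    N f = sym (ℤP.+-identityˡ _)
sumBelow-split (suc m) N f = trans (cong₂ _+_ (cong f (ℕP.+-comm m N)) (sumBelow-split m N f))
  (sym (ℤP.+-assoc (f (N ℕ.+ m)) _ _))

sumBelow-mono : ∀ N (f g : ℕ → ℤ) → (∀ r → r < N → f r ℤ.≤ g r) → sumBelow N f ℤ.≤ sumBelow N g
sumBelow-mono zero    f g f≤g = ℤP.≤-refl
sumBelow-mono (suc N) f g f≤g =
  ℤP.+-mono-≤ (f≤g N ℕP.≤-refl) (sumBelow-mono N f g (λ r r<N → f≤g r (ℕP.m<n⇒m<1+n r<N)))

sumBelow-strict : ∀ N (f g : ℕ → ℤ) → (∀ r → r < N → f r ℤ.≤ g r) →
  ∀ r₀ → r₀ < N → f r₀ ℤ.< g r₀ → sumBelow N f ℤ.< sumBelow N g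
sumBelow-strict (suc N) f g f≤g r₀ r₀<N f<g with r₀ ℕP.≟ N
... | yes refl = ℤP.+-mono-<-≤ f<g (sumBelow-mono N f g (λ r r<N → f≤g r (ℕP.m<n⇒m<1+n r<N)))
... | no r₀≢N  = ℤP.+-mono-≤-< (f≤g N ℕP.≤-refl)
  (sumBelow-strict N f g (λ r r<N → f≤g r (ℕP.m<n⇒m<1+n r<N)) r₀ (ℕP.≤∧≢⇒< (ℕP.≤-pred r₀<N) r₀≢N) f<g)

𝟙 : ∀ {P : Set} → Dec P → ℤ
𝟙 (yes _) = + 1
𝟙 (no _)  = + 0

𝟙-yes : ∀ {P : Set} (d : Dec P) → P → 𝟙 d ≡ + 1
𝟙-yes (yes _) p = refl
𝟙-yes (no ¬p) p = ⊥-elim (¬p p)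

𝟙-no : ∀ {P : Set} (d : Dec P) → ¬ P → 𝟙 d ≡ + 0
𝟙-no (yes p) ¬p = ⊥-elim (¬p p)
𝟙-no (no _)  ¬p = refl

𝟙-cong : ∀ {P Q : Set} (d : Dec P) (e : Dec Q) → (P → Q) → (Q → P) → 𝟙 d ≡ 𝟙 e
𝟙-cong (yes p) (yes q) f g = refl
𝟙-cong (yes p) (no ¬q) f g = ⊥-elim (¬q (f p))
𝟙-cong (no ¬p) (yes q) f g = ⊥-elim (¬p (g q))
𝟙-cong (no ¬p) (no ¬q) f g = refl

count-multiples : ∀ m → 0 < m → ∀ d → sumBelow (d ℕ.* m) (λ r → 𝟙 (m ∣? r)) ≡ + d
count-multiples m 0<m zero    = refl
count-multiples m 0<m (suc d) = begin
  sumBelow (m ℕ.+ d ℕ.* m) (λ r → 𝟙 (m ∣? r))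
    ≡⟨ sumBelow-split m (d ℕ.* m) _ ⟩
  sumBelow m (λ i → 𝟙 (m ∣? d ℕ.* m ℕ.+ i)) + sumBelow (d ℕ.* m) (λ r → 𝟙 (m ∣? r))
    ≡⟨ cong₂ _+_ (trans (sumBelow-cong m shift) (one-block m 0<m ℕP.≤-refl)) (count-multiples m 0<m d) ⟩
  + 1 + + d
    ∎
  where
  open ≡-Reasoning
  shift : ∀ i → i < m → 𝟙 (m ∣? d ℕ.* m ℕ.+ i) ≡ 𝟙 (m ∣? i)
  shift i _ = 𝟙-cong (m ∣? _) (m ∣? i) (λ m∣ → ∣m+n∣m⇒∣n m∣ (n∣m*n d)) (∣m∣n⇒∣m+n (n∣m*n d))
  one-block : ∀ k → 0 < k → k ≤ m → sumBelow k (λ i → 𝟙 (m ∣? i)) ≡ + 1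
  one-block (suc zero)    _ _   = trans (ℤP.+-identityʳ _) (𝟙-yes (m ∣? 0) (m ∣0))
  one-block (suc (suc k)) _ k<m = trans
    (cong₂ _+_ (𝟙-no (m ∣? suc k) (λ m∣ → ℕP.<⇒≱ k<m (∣⇒≤ m∣)))
               (one-block (suc k) (s≤s z≤n) (ℕP.<⇒≤ k<m)))
    refl

-- Σ_{r<M} [M ∣ r·b] = gcd(M,b): with M = m·d, d = gcd(M,b), the condition
-- M ∣ r·b is equivalent to m ∣ r, which holds for d of the r < M.
count-divisible-products : ∀ M → 0 < M → ∀ b → sumBelow M (λ r → 𝟙 (M ∣? r ℕ.* b)) ≡ + gcd M b
count-divisible-products M 0<M b with gcd[m,n]∣m M b | gcd[m,n]∣n M b
... | divides m M≡md | divides b′ b≡b′d = begin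
  sumBelow M (λ r → 𝟙 (M ∣? r ℕ.* b)) ≡⟨ sumBelow-cong M (λ r _ → 𝟙-cong (M ∣? _) (m ∣? r) (to r) (from r)) ⟩
  sumBelow M (λ r → 𝟙 (m ∣? r))       ≡⟨ cong (λ z → sumBelow z (λ r → 𝟙 (m ∣? r))) (trans M≡md (ℕP.*-comm m d)) ⟩
  sumBelow (d ℕ.* m) (λ r → 𝟙 (m ∣? r)) ≡⟨ count-multiples m 0<m d ⟩
  + d                                  ∎
  where
  open ≡-Reasoning
  d : ℕ
  d = gcd M b
  d≢0 : d ≢ 0
  d≢0 d≡0 = ℕP.<⇒≢ 0<M (sym (trans M≡md (trans (cong (m ℕ.*_) d≡0) (ℕP.*-zeroʳ m))))
  instance
    _ : NonZero d
    _ = ℕ.≢-nonZero d≢0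
  0<m : 0 < m
  0<m = ℕP.n≢0⇒n>0 (λ m≡0 → ℕP.<⇒≢ 0<M (sym (trans M≡md (cong (ℕ._* d) m≡0))))
  m⊥b′ : gcd m b′ ≡ 1
  m⊥b′ = ℕP.*-cancelˡ-≡ (gcd m b′) 1 d (begin
    d ℕ.* gcd m b′             ≡⟨ c*gcd[m,n]≡gcd[cm,cn] d m b′ ⟩
    gcd (d ℕ.* m) (d ℕ.* b′)   ≡⟨ cong₂ gcd (trans (ℕP.*-comm d m) (sym M≡md)) (trans (ℕP.*-comm d b′) (sym b≡b′d)) ⟩
    d                          ≡⟨ ℕP.*-identityʳ d ⟨
    d ℕ.* 1                    ∎)
  to : ∀ r → M ∣ r ℕ.* b → m ∣ r
  to r M∣rb = coprime-divisor (gcd≡1⇒coprime m⊥b′)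
    (subst (m ∣_) (ℕP.*-comm r b′) (*-cancelʳ-∣ d
      (subst₂ _∣_ M≡md (trans (cong (r ℕ.*_) b≡b′d) (sym (ℕP.*-assoc r b′ d))) M∣rb)))
  from : ∀ r → m ∣ r → M ∣ r ℕ.* b
  from r m∣r = subst₂ _∣_ (sym M≡md) (trans (reorder r d b′) (cong (r ℕ.*_) (sym b≡b′d)))
    (∣m⇒∣m*n b′ (*-monoˡ-∣ d m∣r))
    where reorder : ∀ r d b′ → r ℕ.* d ℕ.* b′ ≡ r ℕ.* (b′ ℕ.* d)
          reorder = ℕSolver.solve-∀

-- The inclusion–exclusion sum of f over the gcd-lattice generated by a and H:
--   Alt f a [h₁,…,h_k] = Σ_{J ⊆ {1,…,k}} (-1)^|J| f (gcd(a, h_j : j ∈ J)).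
Alt : (ℕ → ℤ) → ℕ → List ℕ → ℤ
Alt f a []      = f a
Alt f a (h ∷ H) = Alt f a H - Alt f (gcd a h) H

Alt-ext : ∀ {f f′ : ℕ → ℤ} → (∀ v → f v ≡ f′ v) → ∀ a H → Alt f a H ≡ Alt f′ a H
Alt-ext e a []      = e a
Alt-ext e a (h ∷ H) = cong₂ _-_ (Alt-ext e a H) (Alt-ext e (gcd a h) H)

Alt-invariant : ∀ {f f′ : ℕ → ℤ} (P Q : ℕ → Set) → (∀ b h → Q h → P b → P (gcd b h)) →
  (∀ b → P b → f b ≡ f′ b) → ∀ a H → P a → All Q H → Alt f a H ≡ Alt f′ a H
Alt-invariant P Q closed e a []      Pa []         = e a Pa
Alt-invariant P Q closed e a (h ∷ H) Pa (Qh ∷ QH) = cong₂ _-_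
  (Alt-invariant P Q closed e a H Pa QH)
  (Alt-invariant P Q closed e (gcd a h) H (closed a h Qh Pa) QH)

Alt-shift : ∀ (f : ℕ → ℤ) h a H → Alt f (gcd a h) H ≡ Alt (λ b → f (gcd b h)) a H
Alt-shift f h a []       = refl
Alt-shift f h a (h′ ∷ H) = cong₂ _-_ (Alt-shift f h a H)
  (trans (cong (λ z → Alt f z H) (swap a h h′)) (Alt-shift f h (gcd a h′) H))
  where
  swap : ∀ a h h′ → gcd (gcd a h) h′ ≡ gcd (gcd a h′) h
  swap a h h′ = trans (gcd-assoc a h h′) (trans (cong (gcd a) (gcd-comm h h′)) (sym (gcd-assoc a h′ h)))

-- If f is insensitive to taking gcd with some member h of H, the terms with
-- and without h cancel and the inclusion–exclusion sum vanishes.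
Alt-vanish : ∀ (f : ℕ → ℤ) a H → Any (λ h → ∀ b → f (gcd b h) ≡ f b) H → Alt f a H ≡ + 0
Alt-vanish f a (h ∷ H) (here f∘gcd≗f) = trans
  (cong (_-_ (Alt f a H)) (trans (Alt-shift f h a H) (Alt-ext f∘gcd≗f a H)))
  (ℤP.+-inverseʳ (Alt f a H))
Alt-vanish f a (h ∷ H) (there p) = cong₂ _-_ (Alt-vanish f a H p) (Alt-vanish f (gcd a h) H p)

Alt-const : ∀ (c : ℤ) a {h} H → h ∈ H → Alt (λ _ → c) a H ≡ + 0
Alt-const c a H h∈H = Alt-vanish (λ _ → c) a H (lose h∈H (λ _ → refl))

Alt-sum : ∀ N (f : ℕ → ℕ → ℤ) a H →
  Alt (λ v → sumBelow N (λ r → f r v)) a H ≡ sumBelow N (λ r → Alt (f r) a H)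
Alt-sum N f a []      = refl
Alt-sum N f a (h ∷ H) = trans (cong₂ _-_ (Alt-sum N f a H) (Alt-sum N f (gcd a h) H))
  (sym (sumBelow-- N (λ r → Alt (f r) a H) (λ r → Alt (f r) (gcd a h) H)))

Π[1-_] : (ℕ → ℤ) → List ℕ → ℤ
Π[1- χ ] []      = + 1
Π[1- χ ] (h ∷ H) = (+ 1 - χ h) * Π[1- χ ] H

Alt-multiplicative : ∀ (χ : ℕ → ℤ) → (∀ b h → χ (gcd b h) ≡ χ b * χ h) →
  ∀ a H → Alt χ a H ≡ χ a * Π[1- χ ] H
Alt-multiplicative χ χ-mult a []      = sym (ℤP.*-identityʳ _)
Alt-multiplicative χ χ-mult a (h ∷ H) = begin
  Alt χ a H - Alt χ (gcd a h) H                     ≡⟨ cong₂ _-_ (Alt-multiplicative χ χ-mult a H) (Alt-multiplicative χ χ-mult (gcd a h) H) ⟩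
  χ a * Π[1- χ ] H - χ (gcd a h) * Π[1- χ ] H       ≡⟨ cong (λ z → χ a * Π[1- χ ] H - z * Π[1- χ ] H) (χ-mult a h) ⟩
  χ a * Π[1- χ ] H - χ a * χ h * Π[1- χ ] H         ≡⟨ factor (χ a) (χ h) (Π[1- χ ] H) ⟩
  χ a * ((+ 1 - χ h) * Π[1- χ ] H)                  ∎
  where
  open ≡-Reasoning
  factor : ∀ a b c → a * c - a * b * c ≡ a * ((+ 1 - b) * c)
  factor = solve-∀

divIndicator : ℕ → ℕ → ℕ → ℤ
divIndicator M s v = 𝟙 (M ∣? s ℕ.* v)

divIndicator-gcd : ∀ M s b h → divIndicator M s (gcd b h) ≡ divIndicator M s b * divIndicator M s h
divIndicator-gcd M s b h with M ∣? s ℕ.* b | M ∣? s ℕ.* h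
... | yes M∣sb | yes M∣sh = 𝟙-yes (M ∣? _)
  (subst (M ∣_) (sym (c*gcd[m,n]≡gcd[cm,cn] s b h)) (gcd-greatest M∣sb M∣sh))
... | no ¬M∣sb | _        = 𝟙-no (M ∣? _) (λ M∣ → ¬M∣sb (∣-trans M∣ (*-monoʳ-∣ s (gcd[m,n]∣m b h))))
... | yes _    | no ¬M∣sh = 𝟙-no (M ∣? _) (λ M∣ → ¬M∣sh (∣-trans M∣ (*-monoʳ-∣ s (gcd[m,n]∣n b h))))

avoids : ℕ → ℕ → List ℕ → ℤ
avoids M s = Π[1- (λ v → divIndicator M s v) ]

avoids-one : ∀ M s H → All (λ h → ¬ M ∣ s ℕ.* h) H → avoids M s H ≡ + 1
avoids-one M s []      []           = refl
avoids-one M s (h ∷ H) (¬M∣ ∷ ¬M∣s) =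
  cong₂ (λ a b → (+ 1 - a) * b) (𝟙-no (M ∣? s ℕ.* h) ¬M∣) (avoids-one M s H ¬M∣s)

avoids-zero : ∀ M s H → Any (λ h → M ∣ s ℕ.* h) H → avoids M s H ≡ + 0
avoids-zero M s (h ∷ H) (here M∣) = cong (λ a → (+ 1 - a) * avoids M s H) (𝟙-yes (M ∣? s ℕ.* h) M∣)
avoids-zero M s (h ∷ H) (there p) =
  trans (cong ((+ 1 - divIndicator M s h) *_) (avoids-zero M s H p)) (ℤP.*-zeroʳ (+ 1 - divIndicator M s h))

avoids-one⁻¹ : ∀ M s H → avoids M s H ≡ + 1 → ∀ {h} → h ∈ H → ¬ M ∣ s ℕ.* h
avoids-one⁻¹ M s H avoids≡1 h∈H M∣sh with () ← trans (sym (avoids-zero M s H (lose h∈H M∣sh))) avoids≡1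

avoids-0-or-1 : ∀ M s H → avoids M s H ≡ + 0 ⊎ avoids M s H ≡ + 1
avoids-0-or-1 M s [] = inj₂ refl
avoids-0-or-1 M s (h ∷ H) with M ∣? s ℕ.* h | avoids-0-or-1 M s H
... | yes _ | _      = inj₁ refl
... | no _  | inj₁ e = inj₁ (cong (+ 1 *_) e)
... | no _  | inj₂ e = inj₂ (cong (+ 1 *_) e)

avoids-nonneg : ∀ M s H → + 0 ℤ.≤ avoids M s H
avoids-nonneg M s H with avoids-0-or-1 M s H
... | inj₁ avoids≡0 = ℤP.≤-reflexive (sym avoids≡0)
... | inj₂ avoids≡1 = subst (+ 0 ℤ.≤_) (sym avoids≡1) (ℤ.+≤+ z≤n)

Alt-gcd-count : ∀ M → 0 < M → ∀ s a H → M ∣ s ℕ.* a →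
  Alt (λ v → + gcd M (s ℕ.* v)) a H ≡ sumBelow M (λ r → avoids M (r ℕ.* s) H)
Alt-gcd-count M 0<M s a H M∣sa = begin
  Alt (λ v → + gcd M (s ℕ.* v)) a H
    ≡⟨ Alt-ext (λ v → sym (trans (sumBelow-cong M (λ r _ → reassoc r v)) (count-divisible-products M 0<M (s ℕ.* v)))) a H ⟩
  Alt (λ v → sumBelow M (λ r → divIndicator M (r ℕ.* s) v)) a H
    ≡⟨ Alt-sum M (λ r v → divIndicator M (r ℕ.* s) v) a H ⟩
  sumBelow M (λ r → Alt (λ v → divIndicator M (r ℕ.* s) v) a H)
    ≡⟨ sumBelow-cong M (λ r _ → Alt-multiplicative _ (divIndicator-gcd M (r ℕ.* s)) a H) ⟩
  sumBelow M (λ r → divIndicator M (r ℕ.* s) a * avoids M (r ℕ.* s) H)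
    ≡⟨ sumBelow-cong M (λ r _ → trans (cong (_* avoids M (r ℕ.* s) H) (M∣rsa r)) (ℤP.*-identityˡ _)) ⟩
  sumBelow M (λ r → avoids M (r ℕ.* s) H)
    ∎
  where
  open ≡-Reasoning
  reassoc : ∀ r v → divIndicator M (r ℕ.* s) v ≡ divIndicator M r (s ℕ.* v)
  reassoc r v = 𝟙-cong (M ∣? _) (M ∣? _) (subst (M ∣_) (ℕP.*-assoc r s v)) (subst (M ∣_) (sym (ℕP.*-assoc r s v)))
  M∣rsa : ∀ r → divIndicator M (r ℕ.* s) a ≡ + 1
  M∣rsa r = 𝟙-yes (M ∣? _) (subst (M ∣_) (sym (ℕP.*-assoc r s a)) (∣n⇒∣m*n r M∣sa))

gcd-absorbs : ∀ {a b} → a ∣ b → gcd b a ≡ a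
gcd-absorbs {a} {b} a∣b = ∣-antisym (gcd[m,n]∣n b a) (gcd-greatest a∣b ∣-refl)

Alt-gcd-vanish : ∀ y a H → Any (y ∣_) H → Alt (λ v → + gcd v y) a H ≡ + 0
Alt-gcd-vanish y a H y∣h = Alt-vanish (λ v → + gcd v y) a H (Any.map absorb y∣h)
  where
  absorb : ∀ {h} → y ∣ h → ∀ b → + gcd (gcd b h) y ≡ + gcd b y
  absorb {h} y∣h b = cong +_ (trans (gcd-assoc b h y) (cong (gcd b) (gcd-absorbs y∣h)))

module _ (a : ℕ) {g : ℕ} (u : ℕ) {e : ℕ} .{{_ : NonZero e}} (g≡ue : g ≡ u ℕ.* e) (gcd≡e : gcd a g ≡ e) where

  lcm-of-gcd : lcm a g ≡ u ℕ.* a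
  lcm-of-gcd = ℕP.*-cancelʳ-≡ (lcm a g) (u ℕ.* a) e (begin
    lcm a g ℕ.* e          ≡⟨ ℕP.*-comm (lcm a g) e ⟩
    e ℕ.* lcm a g          ≡⟨ cong (ℕ._* lcm a g) gcd≡e ⟨
    gcd a g ℕ.* lcm a g    ≡⟨ gcd*lcm a g ⟩
    a ℕ.* g                ≡⟨ cong (a ℕ.*_) g≡ue ⟩
    a ℕ.* (u ℕ.* e)        ≡⟨ reorder a u e ⟩
    u ℕ.* a ℕ.* e          ∎)
    where
    open ≡-Reasoning
    reorder : ∀ a u e → a ℕ.* (u ℕ.* e) ≡ u ℕ.* a ℕ.* e
    reorder = ℕSolver.solve-∀

  -- Under the same hypotheses a/e is coprime to u, so a ∣ u·b implies a ∣ b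
  -- for every multiple b of e.
  cancel-cofactor : e ∣ a → ∀ {b} → e ∣ b → a ∣ u ℕ.* b → a ∣ b
  cancel-cofactor e∣a {b} (divides q b≡qe) a∣ub = subst₂ _∣_ (sym a≡se) (sym b≡qe) (*-monoˡ-∣ e s∣q)
    where
    s : ℕ
    s = quotient e∣a
    a≡se : a ≡ s ℕ.* e
    a≡se = m∣n⇒n≡quotient*m e∣a
    s⊥u : gcd s u ≡ 1
    s⊥u = ℕP.*-cancelˡ-≡ (gcd s u) 1 e (begin
      e ℕ.* gcd s u             ≡⟨ c*gcd[m,n]≡gcd[cm,cn] e s u ⟩
      gcd (e ℕ.* s) (e ℕ.* u)   ≡⟨ cong₂ gcd (trans (ℕP.*-comm e s) (sym a≡se)) (trans (ℕP.*-comm e u) (sym g≡ue)) ⟩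
      gcd a g                   ≡⟨ trans gcd≡e (sym (ℕP.*-identityʳ e)) ⟩
      e ℕ.* 1                   ∎)
      where open ≡-Reasoning
    s∣q : s ∣ q
    s∣q = coprime-divisor (gcd≡1⇒coprime s⊥u) (*-cancelʳ-∣ e
      (subst₂ _∣_ a≡se (trans (cong (u ℕ.*_) b≡qe) (sym (ℕP.*-assoc u q e))) a∣ub))

divisor-pos : ∀ {z M} → 0 < M → z ∣ M → 0 < z
divisor-pos {zero}  0<M 0∣M = ⊥-elim (ℕP.<⇒≢ 0<M (sym (0∣⇒≡0 0∣M)))
divisor-pos {suc z} 0<M _   = s≤s z≤n

-- Every proper divisor y of M lying in S divides a greatest-type divisor of M
-- (climb from y to a maximal element of S strictly between y and M).
below-some-GTD : ∀ {t} (x : Fin t → ℕ) {M} → 0 < M → M ∈S x →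
  ∀ {y} → y ∈S x → y ∣ M → y ≢ M → ¬ ¬ (∃ λ a → IsGTD x a M × y ∣ a)
below-some-GTD x {M} 0<M M∈S {y} = climb (suc (M ∸ y)) (ℕP.n<1+n _)
  where
  instance
    _ : NonZero M
    _ = ℕ.>-nonZero 0<M
  climb : ∀ fuel {y} → M ∸ y < fuel → y ∈S x → y ∣ M → y ≢ M → ¬ ¬ (∃ λ a → IsGTD x a M × y ∣ a)
  climb (suc fuel) {y} M∸y<fuel y∈S y∣M y≢M noGTD = noGTD (y , (y∈S , M∈S , y<M , y∣M , maximal) , ∣-refl)
    where
    y<M : y < M
    y<M = ℕP.≤∧≢⇒< (∣⇒≤ y∣M) y≢M
    maximal : ∀ z → z ∈S x → y ∣ z → z ∣ M → z ≡ y ⊎ z ≡ M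
    maximal z z∈S y∣z z∣M with z ℕP.≟ y | z ℕP.≟ M
    ... | yes z≡y | _       = inj₁ z≡y
    ... | no _    | yes z≡M = inj₂ z≡M
    ... | no z≢y  | no z≢M  = ⊥-elim (climb fuel M∸z<fuel z∈S z∣M z≢M
          (λ (a , gtd , z∣a) → noGTD (a , gtd , ∣-trans y∣z z∣a)))
      where
      y<z : y < z
      y<z = ℕP.≤∧≢⇒< (∣⇒≤ {{ℕ.>-nonZero (divisor-pos 0<M z∣M)}} y∣z) (λ y≡z → z≢y (sym y≡z))
      M∸z<fuel : M ∸ z < fuel
      M∸z<fuel = ℕP.<-≤-trans (ℕP.∸-monoʳ-< y<z (∣⇒≤ z∣M)) (ℕP.≤-pred M∸y<fuel)

-- For a gcd-closed set the inclusion–exclusion sum is realised by an integer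
-- row vector: ieVector a H has entries Σ_{J ⊆ H} (-1)^|J| at the index of
-- gcd(a, J), so its product with a column F ∘ x is Alt F (x a) (map x H).
module InclusionExclusionVector {t : ℕ} (x : Fin t → ℕ) (closed : GcdClosed x) where

  meet : Fin t → Fin t → Fin t
  meet a b = proj₁ (closed a b)

  ieVector : Fin t → List (Fin t) → Fin t → ℤ
  ieVector a []      = δ a
  ieVector a (h ∷ H) = λ k → ieVector a H k - ieVector (meet a h) H k

  ieVector-dot : ∀ a H (F : ℕ → ℤ) → sumFin t (λ i → ieVector a H i * F (x i)) ≡ Alt F (x a) (map x H)
  ieVector-dot a []      F = sumFin-δ t a (λ i → F (x i))
  ieVector-dot a (h ∷ H) F = begin
    sumFin t (λ i → (ieVector a H i - ieVector (meet a h) H i) * F (x i))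
      ≡⟨ sumFin-cong t (λ i → distrib (ieVector a H i) (ieVector (meet a h) H i) (F (x i))) ⟩
    sumFin t (λ i → ieVector a H i * F (x i) - ieVector (meet a h) H i * F (x i))
      ≡⟨ sumFin-- t _ _ ⟩
    sumFin t (λ i → ieVector a H i * F (x i)) - sumFin t (λ i → ieVector (meet a h) H i * F (x i))
      ≡⟨ cong₂ _-_ (ieVector-dot a H F) (ieVector-dot (meet a h) H F) ⟩
    Alt F (x a) (map x H) - Alt F (x (meet a h)) (map x H)
      ≡⟨ cong (λ z → Alt F (x a) (map x H) - Alt F z (map x H)) (proj₂ (closed a h)) ⟩
    Alt F (x a) (map x H) - Alt F (gcd (x a) (x h)) (map x H)
      ∎
    where
    open ≡-Reasoning
    distrib : ∀ a b c → (a - b) * c ≡ a * c - b * c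
    distrib = solve-∀

module ChainSetting
  {t : ℕ} (x : Fin t → ℕ) (x-injective : Injective _≡_ _≡_ x) (x-pos : ∀ i → 0 < x i)
  (closed : GcdClosed x) (n : Fin t) (others∣M : ∀ k → k ≢ n → x k ∣ x n)
  (isGTD : Fin t → Set) (isGTD? : ∀ i → Dec (isGTD i))
  (isGTD⇔ : ∀ a → IsGTD x a (x n) ⇔ (∃ λ i → isGTD i × x i ≡ a))
  (i₁ i₂ i₃ : Fin t) (G₁ : isGTD i₁) (G₂ : isGTD i₂) (G₃ : isGTD i₃)
  (x₁≢x₂ : x i₁ ≢ x i₂) (x₁≢x₃ : x i₁ ≢ x i₃) (x₂≢x₃ : x i₂ ≢ x i₃)
  (e : ℕ) (e-gcd : IsGcdOf (λ a → IsGTD x a (x n)) e)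
  (chain : DivisorChain (InD x (x n))) where

  M : ℕ
  M = x n

  gtd : ∀ {i} → isGTD i → IsGTD x (x i) M
  gtd {i} Gi = Equivalence.from (isGTD⇔ (x i)) (i , Gi , refl)

  G∣M : ∀ {i} → isGTD i → x i ∣ M
  G∣M Gi = proj₁ (proj₂ (proj₂ (proj₂ (gtd Gi))))

  e∣G : ∀ {i} → isGTD i → e ∣ x i
  e∣G Gi = proj₁ e-gcd _ (gtd Gi)

  instance
    e≢0 : NonZero e
    e≢0 = ℕ.>-nonZero (divisor-pos (x-pos i₁) (e∣G G₁))

  antichain : ∀ {i j} → isGTD i → isGTD j → x i ≢ x j → ¬ x i ∣ x j
  antichain {i} {j} Gi Gj xi≢xj xi∣xj
    with proj₂ (proj₂ (proj₂ (proj₂ (gtd Gi)))) (x j) (j , refl) xi∣xj (G∣M Gj)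
  ... | inj₁ xj≡xi = xi≢xj (sym xj≡xi)
  ... | inj₂ xj≡M  = ℕP.<⇒≢ (proj₁ (proj₂ (proj₂ (gtd Gj)))) xj≡M

  -- Any two distinct greatest-type divisors have comparable gcds, since these lie in D_S(M).
  comparable : ∀ {i j k l} → isGTD i → isGTD j → isGTD k → isGTD l → x i ≢ x j → x k ≢ x l →
    gcd (x i) (x j) ∣ gcd (x k) (x l) ⊎ gcd (x k) (x l) ∣ gcd (x i) (x j)
  comparable Gi Gj Gk Gl xi≢xj xk≢xl = chain _ _ (inD Gi Gj xi≢xj) (inD Gk Gl xk≢xl)
    where
    inD : ∀ {i j} → isGTD i → isGTD j → x i ≢ x j → InD x M (gcd (x i) (x j))
    inD {i} {j} Gi Gj xi≢xj = (x i ∷ x j ∷ []) , ((xi≢xj ∷ []) ∷ [] ∷ []) ,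
      (gtd Gi ∷ gtd Gj ∷ []) , s≤s (s≤s z≤n) , cong (gcd (x i)) (gcd-identityʳ (x j))

  record GTDPair : Set where
    constructor gtdPair
    field
      {a b} : Fin t
      Ga    : isGTD a
      Gb    : isGTD b
      a≢b   : x a ≢ x b

  pairGcd : GTDPair → ℕ
  pairGcd p = gcd (x (GTDPair.a p)) (x (GTDPair.b p))

  refine : ∀ p {h} → isGTD h → Σ GTDPair λ q → pairGcd q ∣ pairGcd p × pairGcd q ∣ x h
  refine p@(gtdPair {a} {b} Ga Gb a≢b) {h} Gh with x h ℕP.≟ x a | x h ℕP.≟ x b
  ... | yes h≡a | _ = p , ∣-refl , subst (pairGcd p ∣_) (sym h≡a) (gcd[m,n]∣m (x a) (x b))
  ... | no _ | yes h≡b = p , ∣-refl , subst (pairGcd p ∣_) (sym h≡b) (gcd[m,n]∣n (x a) (x b))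
  ... | no h≢a | no h≢b with comparable Gh Ga Gh Gb h≢a h≢b
  ...   | inj₁ ha∣hb = gtdPair Gh Ga h≢a ,
          gcd-greatest (gcd[m,n]∣n (x h) (x a)) (∣-trans ha∣hb (gcd[m,n]∣n (x h) (x b))) ,
          gcd[m,n]∣m (x h) (x a)
  ...   | inj₂ hb∣ha = gtdPair Gh Gb h≢b ,
          gcd-greatest (∣-trans hb∣ha (gcd[m,n]∣n (x h) (x a))) (gcd[m,n]∣n (x h) (x b)) ,
          gcd[m,n]∣m (x h) (x b)

  scan : ∀ H → Σ GTDPair λ p → All (λ h → isGTD h → pairGcd p ∣ x h) H
  scan []      = gtdPair G₁ G₂ x₁≢x₂ , []
  scan (h ∷ H) with scan H | isGTD? h
  ... | p , p∣H | no ¬Gh = p , (λ Gh → ⊥-elim (¬Gh Gh)) ∷ p∣H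
  ... | p , p∣H | yes Gh with refine p Gh
  ...   | q , q∣p , q∣h = q , (λ _ → q∣h) ∷ All.map (λ p∣ Gk → ∣-trans q∣p (p∣ Gk)) p∣H

  pair-with-gcd-e : Σ GTDPair λ p → pairGcd p ≡ e
  pair-with-gcd-e with scan (allFin t)
  ... | p@(gtdPair {a} {b} Ga Gb _) , p∣all = p , ∣-antisym p∣e (gcd-greatest (e∣G Ga) (e∣G Gb))
    where
    p∣e : pairGcd p ∣ e
    p∣e = proj₂ e-gcd _ λ y gtd-y → p∣index (Equivalence.to (isGTD⇔ y) gtd-y)
      where p∣index : ∀ {y} → (∃ λ i → isGTD i × x i ≡ y) → pairGcd p ∣ y
            p∣index (i , Gi , refl) = All.lookup p∣all (∈-allFin i) Gi

  Isolated : Fin t → Set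
  Isolated g = ∀ {i} → isGTD i → x i ≢ x g → gcd (x g) (x i) ≡ e

  -- One of the two members of that pair is isolated: otherwise gcd(a,i) ≠ e ≠ gcd(b,j),
  -- yet one of these two comparable gcds divides both a and b, hence divides e.
  isolated-exists : ¬ ¬ (∃ λ g → isGTD g × Isolated g)
  isolated-exists none with pair-with-gcd-e
  ... | gtdPair {a} {b} Ga Gb _ , ab≡e =
    none (a , Ga , λ Gi i≢a → decidable-stable (_ ℕP.≟ e) λ ai≢e →
    none (b , Gb , λ Gj j≢b → decidable-stable (_ ℕP.≟ e) λ bj≢e →
      clash Gi Gj i≢a j≢b ai≢e bj≢e))
    where
    clash : ∀ {i j} → isGTD i → isGTD j → x i ≢ x a → x j ≢ x b →
      gcd (x a) (x i) ≢ e → gcd (x b) (x j) ≢ e → ⊥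
    clash {i} {j} Gi Gj i≢a j≢b ai≢e bj≢e with comparable Ga Gi Gb Gj (≢-sym i≢a) (≢-sym j≢b)
    ... | inj₁ ai∣bj = ai≢e (∣-antisym
          (subst (gcd (x a) (x i) ∣_) ab≡e (gcd-greatest (gcd[m,n]∣m (x a) (x i)) (∣-trans ai∣bj (gcd[m,n]∣m (x b) (x j)))))
          (gcd-greatest (e∣G Ga) (e∣G Gi)))
    ... | inj₂ bj∣ai = bj≢e (∣-antisym
          (subst (gcd (x b) (x j) ∣_) ab≡e (gcd-greatest (∣-trans bj∣ai (gcd[m,n]∣m (x a) (x i))) (gcd[m,n]∣m (x b) (x j))))
          (gcd-greatest (e∣G Gb) (e∣G Gj)))

  0<M : 0 < M
  0<M = x-pos n

  1<M : 1 < M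
  1<M = ℕP.≤-<-trans (x-pos i₁) (proj₁ (proj₂ (proj₂ (gtd G₁))))

  below-some-G : ∀ k → k ≢ n → ¬ ¬ (∃ λ i → isGTD i × x k ∣ x i)
  below-some-G k k≢n none = below-some-GTD x 0<M (n , refl) (k , refl) (others∣M k k≢n)
    (λ xk≡M → k≢n (x-injective xk≡M))
    (λ (a , gtd-a , xk∣a) → case (Equivalence.to (isGTD⇔ a) gtd-a) xk∣a)
    where
    case : ∀ {a} → (∃ λ i → isGTD i × x i ≡ a) → x k ∣ a → ⊥
    case (i , Gi , refl) xk∣xi = none (i , Gi , xk∣xi)

  another-G : ∀ p q → ∃ λ i → isGTD i × x i ≢ p × x i ≢ q
  another-G p q with x i₁ ℕP.≟ p ⊎-dec x i₁ ℕP.≟ q | x i₂ ℕP.≟ p ⊎-dec x i₂ ℕP.≟ q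
  ... | no ¬1 | _     = i₁ , G₁ , (λ eq → ¬1 (inj₁ eq)) , (λ eq → ¬1 (inj₂ eq))
  ... | yes _ | no ¬2 = i₂ , G₂ , (λ eq → ¬2 (inj₁ eq)) , (λ eq → ¬2 (inj₂ eq))
  ... | yes 1∈ | yes 2∈ = i₃ , G₃ , (λ eq → pigeon 1∈ 2∈ (inj₁ eq)) , (λ eq → pigeon 1∈ 2∈ (inj₂ eq))
    where
    pigeon : x i₁ ≡ p ⊎ x i₁ ≡ q → x i₂ ≡ p ⊎ x i₂ ≡ q → x i₃ ≡ p ⊎ x i₃ ≡ q → ⊥
    pigeon (inj₁ a) (inj₁ b) _        = x₁≢x₂ (trans a (sym b))
    pigeon (inj₂ a) (inj₂ b) _        = x₁≢x₂ (trans a (sym b))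
    pigeon (inj₁ a) (inj₂ b) (inj₁ c) = x₁≢x₃ (trans a (sym c))
    pigeon (inj₁ a) (inj₂ b) (inj₂ c) = x₂≢x₃ (trans b (sym c))
    pigeon (inj₂ a) (inj₁ b) (inj₁ c) = x₂≢x₃ (trans b (sym c))
    pigeon (inj₂ a) (inj₁ b) (inj₂ c) = x₁≢x₃ (trans a (sym c))

  module WithIsolated {g : Fin t} (Gg : isGTD g) (iso : Isolated g) where

    otherGTD? : ∀ i → Dec (isGTD i × x i ≢ x g)
    otherGTD? i = isGTD? i ×-dec ¬? (x i ℕP.≟ x g)

    others : List (Fin t)
    others = filter otherGTD? (allFin t)

    rest : List ℕ
    rest = map x others

    rest⁻ : ∀ {v} → v ∈ rest → ∃ λ i → isGTD i × x i ≢ x g × v ≡ x i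
    rest⁻ v∈ with ∈-map⁻ x v∈
    ... | i , i∈ , v≡xi with ∈-filter⁻ otherGTD? {xs = allFin t} i∈
    ...   | _ , Gi , xi≢g = i , Gi , xi≢g , v≡xi

    rest⁺ : ∀ {i} → isGTD i → x i ≢ x g → x i ∈ rest
    rest⁺ {i} Gi xi≢g = ∈-map⁺ x (∈-filter⁺ otherGTD? (∈-allFin i) (Gi , xi≢g))

    rest-iso : ∀ {v} → v ∈ rest → gcd v (x g) ≡ e
    rest-iso v∈ with rest⁻ v∈
    ... | i , Gi , xi≢g , refl = trans (gcd-comm (x i) (x g)) (iso Gi xi≢g)

    rest∣M : ∀ {v} → v ∈ rest → v ∣ M
    rest∣M v∈ with rest⁻ v∈
    ... | i , Gi , _ , refl = G∣M Gi

    u : ℕ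
    u = quotient (e∣G Gg)

    g≡ue : x g ≡ u ℕ.* e
    g≡ue = m∣n⇒n≡quotient*m (e∣G Gg)

    h₀-index : Fin t
    h₀-index = proj₁ (another-G (x g) (x g))

    h₀ : ℕ
    h₀ = x h₀-index

    Gh₀ : isGTD h₀-index
    Gh₀ = proj₁ (proj₂ (another-G (x g) (x g)))

    h₀≢g : h₀ ≢ x g
    h₀≢g = proj₁ (proj₂ (proj₂ (another-G (x g) (x g))))

    h₀∈rest : h₀ ∈ rest
    h₀∈rest = rest⁺ Gh₀ h₀≢g

    α V : ℤ
    α = Alt (λ v → + gcd v M) M (x g ∷ rest)
    V = Alt (λ v → + lcm v (x g)) M (x g ∷ rest)

    α-count : α ≡ sumBelow M (λ r → avoids M r (x g ∷ rest))
    α-count = begin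
      α                                                          ≡⟨ Alt-ext (λ v → cong +_ (trans (gcd-comm v M) (cong (gcd M) (sym (ℕP.*-identityˡ v))))) M (x g ∷ rest) ⟩
      Alt (λ v → + gcd M (1 ℕ.* v)) M (x g ∷ rest)               ≡⟨ Alt-gcd-count M 0<M 1 M (x g ∷ rest) (∣-reflexive (sym (ℕP.*-identityˡ M))) ⟩
      sumBelow M (λ r → avoids M (r ℕ.* 1) (x g ∷ rest))         ≡⟨ sumBelow-cong M (λ r _ → cong (λ s → avoids M s (x g ∷ rest)) (ℕP.*-identityʳ r)) ⟩
      sumBelow M (λ r → avoids M r (x g ∷ rest))                 ∎
      where open ≡-Reasoning

    -- V counts the r < M with M ∤ r·u·h for every greatest-type divisor h ≠ g:
    -- along the gcd-lattice of M and the h's, lcm(a, g) = gcd(M, u·a); the part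
    -- of the sum below g vanishes since lcm(·, g) is constant there.
    V-count : V ≡ sumBelow M (λ r → avoids M (r ℕ.* u) rest)
    V-count = trans (cong₂ _-_ reachable below-g) (ℤP.+-identityʳ _)
      where
      Reach : ℕ → Set
      Reach a = a ∣ M × (a ≡ M ⊎ gcd a (x g) ≡ e)
      Gen : ℕ → Set
      Gen v = v ∣ M × gcd v (x g) ≡ e
      reach-gcd : ∀ b h → Gen h → Reach b → Reach (gcd b h)
      reach-gcd b h (h∣M , hg≡e) (b∣M , inj₁ refl) = ∣-trans (gcd[m,n]∣n b h) h∣M ,
        inj₂ (trans (cong (λ z → gcd z (x g)) (gcd-absorbs h∣M)) hg≡e)
      reach-gcd b h (h∣M , hg≡e) (b∣M , inj₂ bg≡e) = ∣-trans (gcd[m,n]∣n b h) h∣M ,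
        inj₂ (trans (gcd-assoc b h (x g)) (trans (cong (gcd b) hg≡e)
          (gcd-absorbs (subst (_∣ b) bg≡e (gcd[m,n]∣m b (x g))))))
      lcm-on-reach : ∀ a → Reach a → + lcm a (x g) ≡ + gcd M (u ℕ.* a)
      lcm-on-reach a (_ , inj₁ refl) = cong +_ (trans
        (∣-antisym (lcm-least ∣-refl (G∣M Gg)) (m∣lcm[m,n] M (x g)))
        (sym (trans (gcd-comm M (u ℕ.* M)) (gcd-absorbs (n∣m*n u)))))
      lcm-on-reach a (a∣M , inj₂ ag≡e) = cong +_ (trans (lcm-of-gcd a u g≡ue ag≡e)
        (sym (gcd-absorbs (subst (_∣ M) (lcm-of-gcd a u g≡ue ag≡e) (lcm-least a∣M (G∣M Gg))))))
      reachable : Alt (λ v → + lcm v (x g)) M rest ≡ sumBelow M (λ r → avoids M (r ℕ.* u) rest)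
      reachable = trans
        (Alt-invariant Reach Gen reach-gcd lcm-on-reach M rest (∣-refl , inj₁ refl)
          (All.tabulate (λ v∈ → rest∣M v∈ , rest-iso v∈)))
        (Alt-gcd-count M 0<M u M rest (n∣m*n u))
      below-g : Alt (λ v → + lcm v (x g)) (gcd M (x g)) rest ≡ + 0
      below-g = trans
        (Alt-invariant (_∣ x g) (λ _ → ⊤) (λ b h _ b∣g → ∣-trans (gcd[m,n]∣m b h) b∣g)
          (λ a a∣g → cong +_ (∣-antisym (lcm-least a∣g ∣-refl) (n∣lcm[m,n] a (x g))))
          (gcd M (x g)) rest (gcd[m,n]∣n M (x g)) (All.tabulate (λ _ → tt)))
        (Alt-const (+ x g) (gcd M (x g)) rest h₀∈rest)

    -- Termwise V ≤ α: if M ∤ r·u·h for all h ≠ g, then M ∤ r·h for those h, and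
    -- M ∤ r·g because r·g = r·u·e divides r·u·h₀.
    avoid-≤ : ∀ r → avoids M (r ℕ.* u) rest ℤ.≤ avoids M r (x g ∷ rest)
    avoid-≤ r with avoids-0-or-1 M (r ℕ.* u) rest
    ... | inj₁ V≡0 = subst (ℤ._≤ _) (sym V≡0) (avoids-nonneg M r (x g ∷ rest))
    ... | inj₂ V≡1 = ℤP.≤-reflexive (trans V≡1 (sym (avoids-one M r (x g ∷ rest) (M∤rg ∷ All.tabulate M∤rh))))
      where
      M∤ruh : ∀ {h} → h ∈ rest → ¬ M ∣ r ℕ.* u ℕ.* h
      M∤ruh = avoids-one⁻¹ M (r ℕ.* u) rest V≡1
      M∤rh : ∀ {h} → h ∈ rest → ¬ M ∣ r ℕ.* h
      M∤rh {h} h∈ M∣rh = M∤ruh h∈ (subst (M ∣_) (reorder r h u) (∣m⇒∣m*n u M∣rh))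
        where reorder : ∀ r h u → r ℕ.* h ℕ.* u ≡ r ℕ.* u ℕ.* h
              reorder = ℕSolver.solve-∀
      M∤rg : ¬ M ∣ r ℕ.* x g
      M∤rg M∣rg = M∤ruh h₀∈rest (∣-trans M∣rg (subst (_∣ r ℕ.* u ℕ.* h₀) (sym (cong (r ℕ.*_) g≡ue))
        (subst (r ℕ.* (u ℕ.* e) ∣_) (sym (ℕP.*-assoc r u h₀)) (*-monoʳ-∣ r (*-monoʳ-∣ u (e∣G Gh₀))))))

    -- The residue r = 1 contributes to V: if M ∣ u·h for some h ≠ g, then a third
    -- greatest-type divisor h′ ∣ M ∣ u·h, and since gcd(h′, g) = e this forces h′ ∣ h.
    avoid-at-1 : avoids M (1 ℕ.* u) rest ≡ + 1
    avoid-at-1 = avoids-one M (1 ℕ.* u) rest (All.tabulate M∤uh)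
      where
      M∤uh : ∀ {v} → v ∈ rest → ¬ M ∣ 1 ℕ.* u ℕ.* v
      M∤uh v∈ M∣uh with rest⁻ v∈
      ... | i , Gi , _ , refl with another-G (x g) (x i)
      ...   | j , Gj , xj≢g , xj≢xi = antichain Gj Gi xj≢xi
              (cancel-cofactor (x j) u g≡ue (trans (gcd-comm (x j) (x g)) (iso Gj xj≢g)) (e∣G Gj) (e∣G Gi)
                (∣-trans (G∣M Gj) (subst (λ z → M ∣ z ℕ.* x i) (ℕP.*-identityˡ u) M∣uh)))

    0<V : + 0 ℤ.< V
    0<V = subst₂ ℤ._<_ (sumBelow-zero M) (sym V-count)
      (sumBelow-strict M (λ _ → + 0) (λ r → avoids M (r ℕ.* u) rest)
        (λ r _ → avoids-nonneg M (r ℕ.* u) rest) 1 1<M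
        (subst (+ 0 ℤ.<_) (sym avoid-at-1) (ℤ.+<+ (s≤s z≤n))))

    -- The residue r₀ = M / lcm(h₀, g) = M / (u·h₀) contributes to α but not to V.
    l : ℕ
    l = u ℕ.* h₀

    l∣M : l ∣ M
    l∣M = subst (_∣ M) (lcm-of-gcd h₀ u g≡ue (rest-iso h₀∈rest)) (lcm-least (G∣M Gh₀) (G∣M Gg))

    r₀ : ℕ
    r₀ = quotient l∣M

    M≡r₀l : M ≡ r₀ ℕ.* l
    M≡r₀l = m∣n⇒n≡quotient*m l∣M

    -- u ≠ 0 as g > 0, and u ≠ 1 as otherwise g = e ∣ h₀.
    2≤u : 2 ≤ u
    2≤u with u in u≡
    ... | zero        = ⊥-elim (ℕP.<⇒≢ (x-pos g) (sym (trans g≡ue (cong (ℕ._* e) u≡))))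
    ... | suc zero    = ⊥-elim (antichain Gg Gh₀ (≢-sym h₀≢g) (subst (_∣ h₀) (sym g≡e) (e∣G Gh₀)))
      where g≡e : x g ≡ e
            g≡e = trans g≡ue (trans (cong (ℕ._* e) u≡) (ℕP.*-identityˡ e))
    ... | suc (suc _) = s≤s (s≤s z≤n)

    1<l : 1 < l
    1<l = ℕP.<-≤-trans (s≤s (s≤s z≤n)) (ℕP.*-mono-≤ 2≤u (x-pos h₀-index))

    instance
      r₀≢0 : NonZero r₀
      r₀≢0 = ℕ.≢-nonZero (λ r₀≡0 → ℕP.<⇒≢ 0<M (sym (trans M≡r₀l (cong (ℕ._* l) r₀≡0))))

    r₀<M : r₀ < M
    r₀<M = subst (r₀ <_) (sym M≡r₀l) (ℕP.m<m*n r₀ l 1<l)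

    avoid-rest-at-r₀ : avoids M (r₀ ℕ.* u) rest ≡ + 0
    avoid-rest-at-r₀ = avoids-zero M (r₀ ℕ.* u) rest
      (lose h₀∈rest (∣-reflexive (trans M≡r₀l (sym (ℕP.*-assoc r₀ u h₀)))))

    -- M ∣ r₀·v means l ∣ v; but l ∣ g would give h₀ ∣ g, and l ∣ h (h ≠ g) would give g = u·e ∣ u·h₀ ∣ h.
    avoid-all-at-r₀ : avoids M r₀ (x g ∷ rest) ≡ + 1
    avoid-all-at-r₀ = avoids-one M r₀ (x g ∷ rest) (M∤r₀g ∷ All.tabulate M∤r₀h)
      where
      l∣ : ∀ {v} → M ∣ r₀ ℕ.* v → l ∣ v
      l∣ M∣r₀v = *-cancelˡ-∣ r₀ (subst (_∣ r₀ ℕ.* _) M≡r₀l M∣r₀v)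
      M∤r₀g : ¬ M ∣ r₀ ℕ.* x g
      M∤r₀g M∣ = antichain Gh₀ Gg h₀≢g (∣-trans (n∣m*n u) (l∣ M∣))
      M∤r₀h : ∀ {v} → v ∈ rest → ¬ M ∣ r₀ ℕ.* v
      M∤r₀h v∈ M∣ with rest⁻ v∈
      ... | i , Gi , xi≢g , refl = antichain Gg Gi (≢-sym xi≢g)
            (∣-trans (subst (_∣ l) (sym g≡ue) (*-monoʳ-∣ u (e∣G Gh₀))) (l∣ M∣))

    V<α : V ℤ.< α
    V<α = subst₂ ℤ._<_ (sym V-count) (sym α-count)
      (sumBelow-strict M _ _ (λ r _ → avoid-≤ r) r₀ r₀<M
        (subst₂ ℤ._<_ (sym avoid-rest-at-r₀) (sym avoid-all-at-r₀) (ℤ.+<+ (s≤s z≤n))))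

    open InclusionExclusionVector x closed

    w : Fin t → ℤ
    w = ieVector n (g ∷ others)

    -- w kills every column k ≠ n of (S): x_k divides some greatest-type divisor,
    -- so the inclusion–exclusion sum of gcd(·, x_k) vanishes.
    w-gcd-column : ∀ k → sumFin t (λ i → w i * GCDMatrix x i k) ≡ α * δ n k
    w-gcd-column k = trans (ieVector-dot n (g ∷ others) (λ v → + gcd v (x k))) column
      where
      hit : ∀ {i} → isGTD i → x k ∣ x i → Any (x k ∣_) (x g ∷ rest)
      hit {i} Gi xk∣xi with x i ℕP.≟ x g
      ... | yes xi≡g = here (subst (x k ∣_) xi≡g xk∣xi)
      ... | no xi≢g  = there (lose (rest⁺ Gi xi≢g) xk∣xi)
      column : Alt (λ v → + gcd v (x k)) M (x g ∷ rest) ≡ α * δ n k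
      column with k F.≟ n
      ... | yes refl = sym (trans (cong (α *_) (δ-refl n)) (ℤP.*-identityʳ α))
      ... | no k≢n  = trans vanish (sym (trans (cong (α *_) (δ-neq n k (≢-sym k≢n))) (ℤP.*-zeroʳ α)))
        where
        vanish : Alt (λ v → + gcd v (x k)) M (x g ∷ rest) ≡ + 0
        vanish = decidable-stable (_ ℤP.≟ + 0) λ ≢0 →
          below-some-G k k≢n λ (i , Gi , xk∣xi) → ≢0 (Alt-gcd-vanish (x k) M _ (hit Gi xk∣xi))

    not-divides : ¬ (GCDMatrix x ∣ₘ LCMMatrix x)
    not-divides = row-criterion (GCDMatrix x) (LCMMatrix x)
      (λ i j → cong +_ (gcd-comm (x i) (x j))) (λ i j → cong +_ (lcm-comm (x i) (x j)))
      w n g α w-gcd-column (subst (+ 0 ℤ.<_) (sym w-lcm-entry) 0<V) (subst (ℤ._< α) (sym w-lcm-entry) V<α)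
      where
      w-lcm-entry : sumFin t (λ i → w i * LCMMatrix x i g) ≡ V
      w-lcm-entry = ieVector-dot n (g ∷ others) (λ v → + lcm v (x g))

  no-division : ¬ (GCDMatrix x ∣ₘ LCMMatrix x)
  no-division S∣L = isolated-exists (λ (g , Gg , iso) → WithIsolated.not-divides Gg iso S∣L)

-- The paper's indexing, 0-based: the greatest-type divisors of x n are the
-- x i with 1 ≤ i < n.
module PaperIndexing {t : ℕ} (x : Fin t → ℕ) (n : Fin t)
  (gtd⇔ : ∀ a → IsGTD x a (x n) ⇔ (∃ λ i → 1 ≤ toℕ i × toℕ i < toℕ n × x i ≡ a)) where

  isGTD : Fin t → Set
  isGTD i = 1 ≤ toℕ i × toℕ i < toℕ n

  isGTD? : ∀ i → Dec (isGTD i)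
  isGTD? i = (1 ℕP.≤? toℕ i) ×-dec (suc (toℕ i) ℕP.≤? toℕ n)

  isGTD⇔ : ∀ a → IsGTD x a (x n) ⇔ (∃ λ i → isGTD i × x i ≡ a)
  isGTD⇔ a = mk⇔
    (λ gtd → let (i , 1≤i , i<n , xi≡a) = Equivalence.to (gtd⇔ a) gtd in i , (1≤i , i<n) , xi≡a)
    (λ (i , (1≤i , i<n) , xi≡a) → Equivalence.from (gtd⇔ a) (i , 1≤i , i<n , xi≡a))

  gtd : ∀ {i} → isGTD i → IsGTD x (x i) (x n)
  gtd {i} Gi = Equivalence.from (isGTD⇔ (x i)) (i , Gi , refl)

  index : ∀ k → 1 ≤ k → k < toℕ n → Σ (Fin t) λ i → isGTD i × toℕ i ≡ k
  index k 1≤k k<n = F.fromℕ< k<t , subst (λ j → 1 ≤ j × j < toℕ n) (sym toℕ≡k) (1≤k , k<n) , toℕ≡k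
    where
    k<t : k < t
    k<t = ℕP.<-trans k<n (FP.toℕ<n n)
    toℕ≡k : toℕ (F.fromℕ< k<t) ≡ k
    toℕ≡k = FP.toℕ-fromℕ< k<t

-- Every element other than x n divides x n: x₀ divides the
-- greatest-type divisor x₁, the x_i with 0 < i < n are greatest-type divisors,
-- and the x_i with i > n divide x n by hypothesis.  Since n ≥ 4, x₁, x₂, x₃ are
-- three distinct greatest-type divisors, so ChainSetting applies.
theorem3p2 : (t : ℕ) (x : Fin t → ℕ) →
    Injective _≡_ _≡_ x → (∀ i → 0 < x i) → GcdClosed x → 5 < t →
    (n : Fin t) → 4 ≤ toℕ n →
    (∀ a → IsGTD x a (x n) ⇔ (∃ λ i → 1 ≤ toℕ i × toℕ i < toℕ n × x i ≡ a)) →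
    (x0 : Fin t) → toℕ x0 ≡ 0 →
    IsGcdOf (λ a → IsGTD x a (x n)) (x x0) →
    (m' : ℕ) → toℕ n ≤ m' → suc m' < t →
    (∀ a → InD x (x n) a ⇔
      (a ≡ x x0 ⊎ (∃ λ i → toℕ n < toℕ i × toℕ i ≤ m' × x i ≡ a))) →
    (∀ i → toℕ n < toℕ i → x i ∣ x n) →
    DivisorChain (InD x (x n)) →
    ¬ (GCDMatrix x ∣ₘ LCMMatrix x)
theorem3p2 t x x-injective x-pos closed _ n 4≤n gtd⇔ x0 x0≡0 e-gcd _ _ _ _ above∣M chain
  with index 1 (s≤s z≤n) 1<n | index 2 (s≤s z≤n) 2<n | index 3 (s≤s z≤n) 4≤n
  where
  open PaperIndexing x n gtd⇔
  2<n : 2 < toℕ n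
  2<n = ℕP.<-≤-trans (s≤s (s≤s (s≤s z≤n))) 4≤n
  1<n : 1 < toℕ n
  1<n = ℕP.<-trans (s≤s (s≤s z≤n)) 2<n
... | i₁ , G₁ , 1≡ | i₂ , G₂ , 2≡ | i₃ , G₃ , 3≡ =
  ChainSetting.no-division x x-injective x-pos closed n others∣M isGTD isGTD? isGTD⇔
    i₁ i₂ i₃ G₁ G₂ G₃ (distinct 1≡ 2≡ λ ()) (distinct 1≡ 3≡ λ ()) (distinct 2≡ 3≡ λ ())
    (x x0) e-gcd chain
  where
  open PaperIndexing x n gtd⇔
  G∣M : ∀ {i} → isGTD i → x i ∣ x n
  G∣M Gi = proj₁ (proj₂ (proj₂ (proj₂ (gtd Gi))))
  distinct : ∀ {i j a b} → toℕ i ≡ a → toℕ j ≡ b → a ≢ b → x i ≢ x j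
  distinct i≡a j≡b a≢b xi≡xj = a≢b (trans (sym i≡a) (trans (cong toℕ (x-injective xi≡xj)) j≡b))
  others∣M : ∀ k → k ≢ n → x k ∣ x n
  others∣M k k≢n with ℕP.<-cmp (toℕ k) (toℕ n) | toℕ k ℕP.≟ 0
  ... | tri< _ _ _   | yes k≡0 = subst (λ j → x j ∣ x n) (FP.toℕ-injective (trans x0≡0 (sym k≡0)))
                                   (∣-trans (proj₁ e-gcd _ (gtd G₁)) (G∣M G₁))
  ... | tri< k<n _ _ | no k≢0  = G∣M (ℕP.n≢0⇒n>0 k≢0 , k<n)
  ... | tri≈ _ k≡n _ | _       = ⊥-elim (k≢n (FP.toℕ-injective k≡n))
  ... | tri> _ _ k>n | _       = above∣M k k>n
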